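{- For every integer $n\ge2$, the polynomials $P_n(z)$ and $P_{n-2}(z)$ have no common complex root other than $-1$.
   Context: For $0\le k\le n$ let $\mathcal{B}(n,k)=\binom{n}{\lfloor (n-k)/2\rfloor}$ and let $P_n(z)=\sum_{k=0}^n\mathcal{B}(n,k)z^{n-k}$. -}

module Defs where

open import Level using (Level)
open import Data.Nat using (ℕ; zero; suc; _∸_; _/_)
open import Data.Nat.Combinatorics using (_C_)
open import Data.Product using (Σ; _×_)
open import Relation.Nullary using (¬_)
open import Algebra.Bundles using (CommutativeRing)

-- A field of characteristic zero, presented as a commutative ring with
-- 1 ≉ 0 in which every nonzero element has a multiplicative inverse and
-- in which n·1 ≉ 0 for every n ≥ 1.  (agda-stdlib has no Field bundle.)

module _ {c ℓ : Level} (R : CommutativeRing c ℓ) where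
  open CommutativeRing R

  fromℕ : ℕ → Carrier
  fromℕ zero    = 0#
  fromℕ (suc n) = 1# + fromℕ n

  pow : Carrier → ℕ → Carrier
  pow x zero    = 1#
  pow x (suc m) = x * pow x m

  record IsCharZeroField : Set (c Level.⊔ ℓ) where
    field
      nontrivial : ¬ (1# ≈ 0#)
      inverse    : ∀ x → ¬ (x ≈ 0#) → Σ Carrier (λ y → x * y ≈ 1#)
      charZero   : ∀ n → ¬ (fromℕ (suc n) ≈ 0#)

  𝓑 : ℕ → ℕ → ℕ
  𝓑 n k = n C ((n ∸ k) / 2)

  partialP : ℕ → Carrier → ℕ → Carrier
  partialP n z zero    = fromℕ (𝓑 n 0) * pow z n
  partialP n z (suc m) = partialP n z m + fromℕ (𝓑 n (suc m)) * pow z (n ∸ suc m)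

  P : ℕ → Carrier → Carrier
  P n z = partialP n z n

-- In ascending powers, P_n(z) = Σ_{j ≤ n} C(n, ⌊j/2⌋) z^j, and Pascal's rule gives the recurrence
-- P_{n+1}(z) = (1 + z²) P_n(z) + β_n z^{n+1} (1 - z) with β_n = C(n, ⌊n/2⌋).  Let P_N(z) = P_{N+2}(z) = 0.
-- Then z ≠ 0, 1 (P_N(0) = 1, P_N(1) = 2^N), and applying the recurrence twice gives
-- β_N (1 + z²) + β_{N+1} z = 0; since m β_{N+1} = c β_N for m = ⌊N/2⌋ + 1 and c = N + 1,
-- z is a root of q(z) = m (1 + z²) + c z.  Reducing the recurrence modulo q shows
-- m^N P_N(z) = z^N (e + s (1 - z)) with integers e = (-c)^N ≠ 0 and s, so e + s (1 - z) = 0.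
-- Substituting 1 - z = -e/s into q yields an integer quadratic form in (e, s) that vanishes;
-- as c ≤ 2m the form is positive semidefinite, which forces 2m e + (2m + c) s = 0, i.e. c + 2m z = 0.
-- Comparing with q gives (2m - c)(2m + c) = 0, so c = 2m and c (1 + z) = 0: z = -1.

module Submission where

open import Defs
open import Level using (Level)
open import Data.Nat as Nat using (ℕ; _≤_; _∸_; zero; suc; ⌊_/2⌋; ⌈_/2⌉)
open import Algebra.Bundles using (CommutativeRing)
import Data.Nat.Properties as ℕP
open import Data.Integer as Int using (ℤ; +_; -[1+_]; 0ℤ; ∣_∣)
import Data.Integer.Properties as ℤP
open import Data.Sum using (inj₁; inj₂)
open import Data.Product using (_,_)
open import Data.Empty using (⊥-elim)
open import Relation.Nullary using (¬_)
import Relation.Binary.PropositionalEquality as ≡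
open ≡ using (_≡_; cong; cong₂; module ≡-Reasoning)

module Binomial where

  open Nat using (_+_; _*_; _<_; s≤s; z≤n)
  open ℕP using (⌊n/2⌋≤n; ⌊n/2⌋+⌈n/2⌉≡n; m+n∸m≡n; m≤m+n; +-mono-≤)
  open import Data.Nat.DivMod using (_/_; m/n≡1+[m∸n]/n)
  open import Data.Nat.Combinatorics using (_C_; nCk≡nC[n∸k]; nC1≡n; nCk+nC[k+1]≡[n+1]C[k+1])
  open import Data.Nat.Tactic.RingSolver using (solve)
  open import Data.List using ([]; _∷_)

  n/2≡⌊n/2⌋ : ∀ n → n / 2 ≡ ⌊ n /2⌋
  n/2≡⌊n/2⌋ 0             = ≡.refl
  n/2≡⌊n/2⌋ 1             = ≡.refl
  n/2≡⌊n/2⌋ (suc (suc n)) = ≡.trans (m/n≡1+[m∸n]/n {suc (suc n)} (s≤s (s≤s z≤n))) (cong suc (n/2≡⌊n/2⌋ n))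

  ⌈n/2⌉≤1+⌊n/2⌋ : ∀ n → ⌈ n /2⌉ ≤ suc ⌊ n /2⌋
  ⌈n/2⌉≤1+⌊n/2⌋ 0             = z≤n
  ⌈n/2⌉≤1+⌊n/2⌋ 1             = s≤s z≤n
  ⌈n/2⌉≤1+⌊n/2⌋ (suc (suc n)) = s≤s (⌈n/2⌉≤1+⌊n/2⌋ n)

  1+n≤2[1+⌊n/2⌋] : ∀ n → suc n ≤ suc ⌊ n /2⌋ + suc ⌊ n /2⌋
  1+n≤2[1+⌊n/2⌋] n = begin
    suc n                      ≡⟨ cong suc (≡.sym (⌊n/2⌋+⌈n/2⌉≡n n)) ⟩
    suc (⌊ n /2⌋ + ⌈ n /2⌉)    ≤⟨ s≤s (+-mono-≤ ℕP.≤-refl (⌈n/2⌉≤1+⌊n/2⌋ n)) ⟩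
    suc ⌊ n /2⌋ + suc ⌊ n /2⌋  ∎
    where open ℕP.≤-Reasoning

  nCk>0 : ∀ {n k} → k ≤ n → 0 < n C k
  nCk>0 {n}     {zero}  _         = s≤s z≤n
  nCk>0 {suc n} {suc k} (s≤s k≤n) = begin-strict
    0                  <⟨ nCk>0 k≤n ⟩
    n C k              ≤⟨ m≤m+n (n C k) (n C suc k) ⟩
    n C k + n C suc k  ≡⟨ nCk+nC[k+1]≡[n+1]C[k+1] n k ⟩
    suc n C suc k      ∎
    where open ℕP.≤-Reasoning

  [1+k]*[1+n]C[1+k]≡[1+n]*nCk : ∀ n k → suc k * (suc n C suc k) ≡ suc n * (n C k)
  [1+k]*[1+n]C[1+k]≡[1+n]*nCk zero    zero    = ≡.refl
  [1+k]*[1+n]C[1+k]≡[1+n]*nCk zero    (suc k) = ℕP.*-zeroʳ (suc (suc k))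
  [1+k]*[1+n]C[1+k]≡[1+n]*nCk (suc n) zero    =
    ≡.trans (ℕP.*-identityˡ _) (≡.trans (nC1≡n (suc (suc n))) (≡.sym (ℕP.*-identityʳ _)))
  [1+k]*[1+n]C[1+k]≡[1+n]*nCk (suc n) (suc k) = begin
    suc (suc k) * (suc (suc n) C suc (suc k))
      ≡⟨ cong (suc (suc k) *_) (≡.sym (nCk+nC[k+1]≡[n+1]C[k+1] (suc n) (suc k))) ⟩
    suc (suc k) * (suc n C suc k + suc n C suc (suc k))
      ≡⟨ step (suc n C suc k) (suc n C suc (suc k)) (n C k) (n C suc k)
           ([1+k]*[1+n]C[1+k]≡[1+n]*nCk n k) ([1+k]*[1+n]C[1+k]≡[1+n]*nCk n (suc k))
           (nCk+nC[k+1]≡[n+1]C[k+1] n k) ⟩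
    suc (suc n) * (suc n C suc k) ∎
    where
    open ≡-Reasoning
    step : ∀ a b x y → suc k * a ≡ suc n * x → suc (suc k) * b ≡ suc n * y → x + y ≡ a →
           suc (suc k) * (a + b) ≡ suc (suc n) * a
    step a b x y p q r = begin
      suc (suc k) * (a + b)            ≡⟨ solve (k ∷ a ∷ b ∷ []) ⟩
      suc k * a + a + suc (suc k) * b  ≡⟨ cong₂ (λ u v → u + a + v) p q ⟩
      suc n * x + a + suc n * y        ≡⟨ solve (n ∷ x ∷ y ∷ a ∷ []) ⟩
      suc n * (x + y) + a              ≡⟨ cong (λ u → suc n * u + a) r ⟩
      suc n * a + a                    ≡⟨ solve (n ∷ a ∷ []) ⟩
      suc (suc n) * a                  ∎

  central : ℕ → ℕ
  central n = n C ⌊ n /2⌋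

  central≡nC⌈n/2⌉ : ∀ n → central n ≡ n C ⌈ n /2⌉
  central≡nC⌈n/2⌉ n = ≡.trans (nCk≡nC[n∸k] (⌊n/2⌋≤n n)) (cong (n C_) n∸⌊n/2⌋≡⌈n/2⌉)
    where
    n∸⌊n/2⌋≡⌈n/2⌉ : n ∸ ⌊ n /2⌋ ≡ ⌈ n /2⌉
    n∸⌊n/2⌋≡⌈n/2⌉ = ≡.trans (cong (_∸ ⌊ n /2⌋) (≡.sym (⌊n/2⌋+⌈n/2⌉≡n n))) (m+n∸m≡n ⌊ n /2⌋ ⌈ n /2⌉)

  central>0 : ∀ n → 0 < central n
  central>0 n = nCk>0 (⌊n/2⌋≤n n)

  [1+⌊n/2⌋]*central[1+n]≡[1+n]*central[n] : ∀ n → suc ⌊ n /2⌋ * central (suc n) ≡ suc n * central n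
  [1+⌊n/2⌋]*central[1+n]≡[1+n]*central[n] n =
    ≡.trans (cong (suc ⌊ n /2⌋ *_) (central≡nC⌈n/2⌉ (suc n))) ([1+k]*[1+n]C[1+k]≡[1+n]*nCk n ⌊ n /2⌋)

open Binomial

module IntegerQuadraticForm where

  open Int using (_+_; _*_; _-_)
  open import Data.Integer.Tactic.RingSolver using (solve-∀)

  i*i≡+∣i∣*∣i∣ : ∀ i → i * i ≡ + (∣ i ∣ Nat.* ∣ i ∣)
  i*i≡+∣i∣*∣i∣ (+ n)    = ≡.sym (ℤP.pos-* n n)
  i*i≡+∣i∣*∣i∣ -[1+ n ] = ≡.refl

  i*i+n*[j*j]≡0⇒i≡0 : ∀ i j n → i * i + + n * (j * j) ≡ 0ℤ → i ≡ 0ℤ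
  i*i+n*[j*j]≡0⇒i≡0 i j n eq =
    ℤP.∣i∣≡0⇒i≡0 (∣i∣*∣i∣≡0⇒∣i∣≡0 (ℕP.m+n≡0⇒m≡0 _ (ℤP.+-injective sum≡0)))
    where
    sum≡0 : + (∣ i ∣ Nat.* ∣ i ∣ Nat.+ n Nat.* (∣ j ∣ Nat.* ∣ j ∣)) ≡ 0ℤ
    sum≡0 = begin
      + (∣ i ∣ Nat.* ∣ i ∣ Nat.+ n Nat.* (∣ j ∣ Nat.* ∣ j ∣))
        ≡⟨ cong (λ x → + (∣ i ∣ Nat.* ∣ i ∣) + x) (ℤP.pos-* n _) ⟩
      + (∣ i ∣ Nat.* ∣ i ∣) + + n * + (∣ j ∣ Nat.* ∣ j ∣)
        ≡⟨ cong₂ (λ x y → x + + n * y) (i*i≡+∣i∣*∣i∣ i) (i*i≡+∣i∣*∣i∣ j) ⟨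
      i * i + + n * (j * j)
        ≡⟨ eq ⟩
      0ℤ ∎
      where open ≡-Reasoning
    ∣i∣*∣i∣≡0⇒∣i∣≡0 : ∣ i ∣ Nat.* ∣ i ∣ ≡ 0 → ∣ i ∣ ≡ 0
    ∣i∣*∣i∣≡0⇒∣i∣≡0 p with ℕP.m*n≡0⇒m≡0∨n≡0 ∣ i ∣ p
    ... | inj₁ q = q
    ... | inj₂ q = q

  completing-the-square : ∀ m c e s →
    (m + m + m + m) * (m * (e * e) + (m + m + c) * (e * s) + (m + m + c) * (s * s))
      ≡ ((m + m) * e + (m + m + c) * s) * ((m + m) * e + (m + m + c) * s)
        + (m + m + c) * ((m + m) - c) * (s * s)
  completing-the-square = solve-∀

  form≡0⇒linear≡0 : ∀ m c e s → c ≤ m Nat.+ m →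
    + m * (e * e) + + (m Nat.+ m Nat.+ c) * (e * s) + + (m Nat.+ m Nat.+ c) * (s * s) ≡ 0ℤ →
    + (m Nat.+ m) * e + + (m Nat.+ m Nat.+ c) * s ≡ 0ℤ
  form≡0⇒linear≡0 m c e s c≤2m form≡0 = i*i+n*[j*j]≡0⇒i≡0 Y s (d Nat.* (m Nat.+ m ∸ c)) (begin
    Y * Y + + (d Nat.* (m Nat.+ m ∸ c)) * (s * s)
      ≡⟨ cong (λ x → Y * Y + x * (s * s)) (ℤP.pos-* d (m Nat.+ m ∸ c)) ⟩
    Y * Y + + d * + (m Nat.+ m ∸ c) * (s * s)
      ≡⟨ cong (λ x → Y * Y + + d * x * (s * s)) (≡.trans (ℤP.m-n≡m⊖n (m Nat.+ m) c) (ℤP.⊖-≥ c≤2m)) ⟨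
    Y * Y + + d * (+ (m Nat.+ m) - + c) * (s * s)
      ≡⟨ completing-the-square (+ m) (+ c) e s ⟨
    (+ m + + m + + m + + m) * (+ m * (e * e) + + d * (e * s) + + d * (s * s))
      ≡⟨ cong ((+ m + + m + + m + + m) *_) form≡0 ⟩
    (+ m + + m + + m + + m) * 0ℤ
      ≡⟨ ℤP.*-zeroʳ (+ m + + m + + m + + m) ⟩
    0ℤ ∎)
    where
    open ≡-Reasoning
    d = m Nat.+ m Nat.+ c
    Y = + (m Nat.+ m) * e + + d * s

open IntegerQuadraticForm

-- The remainder of m^j P_j(z) modulo m(1 + z²) + c z is z^j ((-c)^j + rem m c j · (1 - z)).
rem : ℕ → ℕ → ℕ → ℤ
rem m c zero    = 0ℤ
rem m c (suc j) = Int.- + c Int.* rem m c j Int.+ + (m Nat.^ suc j Nat.* central j)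

module _ {r ℓ : Level} (K : CommutativeRing r ℓ) where

  open CommutativeRing K
  open import Data.Nat.Combinatorics using (_C_; nCk+nC[k+1]≡[n+1]C[k+1])
  open import Algebra.Properties.Semiring.Mult.TCOptimised semiring using (_×_; 1+×; ×-homo-+; ×1-homo-*)
  open import Algebra.Properties.Ring ring using (-‿distribˡ-*; -‿distribʳ-*)
  open import Algebra.Properties.AbelianGroup +-abelianGroup
    using ( ε⁻¹≈ε; ⁻¹-involutive; ⁻¹-∙-comm; ⁻¹-anti-homo‿-; //-rightDividesʳ
          ; x∙y⁻¹≈ε⇒x≈y; x≈y⇒x∙y⁻¹≈ε; inverseʳ-unique )
  open import Algebra.Solver.Ring.AlmostCommutativeRing using (_-Raw-AlmostCommutative⟶_; fromCommutativeRing)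
  import Algebra.Solver.Ring
  open import Data.Maybe using (Maybe; just; nothing)
  open import Relation.Nullary using (yes; no)
  open import Relation.Binary.Reasoning.Setoid setoid
  open Int using () renaming (_+_ to _⊕_; _*_ to _⊛_)

  -- The unit-free multiple _×_ makes the solver constants 1 and 2 evaluate to 1# and 1# + 1#.
  ι : ℕ → Carrier
  ι n = n × 1#

  fromℕ≈ι : ∀ n → fromℕ K n ≈ ι n
  fromℕ≈ι zero    = refl
  fromℕ≈ι (suc n) = trans (+-congˡ (fromℕ≈ι n)) (sym (1+× n 1#))

  ι-+ : ∀ m n → ι (m Nat.+ n) ≈ ι m + ι n
  ι-+ = ×-homo-+ 1#

  ι-* : ∀ m n → ι (m Nat.* n) ≈ ι m * ι n
  ι-* = ×1-homo-*

  fromℤ : ℤ → Carrier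
  fromℤ (+ n)    = ι n
  fromℤ -[1+ n ] = - ι (suc n)

  fromℤ-neg : ∀ i → fromℤ (Int.- i) ≈ - fromℤ i
  fromℤ-neg (+ zero)     = sym ε⁻¹≈ε
  fromℤ-neg Int.+[1+ n ] = refl
  fromℤ-neg -[1+ n ]     = sym (⁻¹-involutive _)

  fromℤ-⊖-≥ : ∀ {m n} → n ≤ m → fromℤ (m Int.⊖ n) ≈ ι m - ι n
  fromℤ-⊖-≥ {m} {n} n≤m = begin
    fromℤ (m Int.⊖ n)        ≡⟨ cong fromℤ (ℤP.⊖-≥ n≤m) ⟩
    ι (m ∸ n)                ≈⟨ //-rightDividesʳ (ι n) (ι (m ∸ n)) ⟨
    ι (m ∸ n) + ι n - ι n    ≈⟨ +-congʳ (ι-+ (m ∸ n) n) ⟨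
    ι (m ∸ n Nat.+ n) - ι n  ≡⟨ cong (λ k → ι k - ι n) (ℕP.m∸n+n≡m n≤m) ⟩
    ι m - ι n                ∎

  fromℤ-⊖ : ∀ m n → fromℤ (m Int.⊖ n) ≈ ι m - ι n
  fromℤ-⊖ m n with ℕP.≤-total n m
  ... | inj₁ n≤m = fromℤ-⊖-≥ n≤m
  ... | inj₂ m≤n = begin
    fromℤ (m Int.⊖ n)          ≡⟨ cong fromℤ (ℤP.⊖-swap m n) ⟩
    fromℤ (Int.- (n Int.⊖ m))  ≈⟨ fromℤ-neg (n Int.⊖ m) ⟩
    - fromℤ (n Int.⊖ m)        ≈⟨ -‿cong (fromℤ-⊖-≥ m≤n) ⟩
    - (ι n - ι m)              ≈⟨ ⁻¹-anti-homo‿- (ι n) (ι m) ⟩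
    ι m - ι n                  ∎

  fromℤ-+ : ∀ i j → fromℤ (i ⊕ j) ≈ fromℤ i + fromℤ j
  fromℤ-+ (+ m)    (+ n)    = ι-+ m n
  fromℤ-+ (+ m)    -[1+ n ] = fromℤ-⊖ m (suc n)
  fromℤ-+ -[1+ m ] (+ n)    = trans (fromℤ-⊖ n (suc m)) (+-comm _ _)
  fromℤ-+ -[1+ m ] -[1+ n ] = begin
    - ι (suc (suc (m Nat.+ n)))  ≡⟨ cong (λ k → - ι k) (≡.sym (ℕP.+-suc (suc m) n)) ⟩
    - ι (suc m Nat.+ suc n)      ≈⟨ -‿cong (ι-+ (suc m) (suc n)) ⟩
    - (ι (suc m) + ι (suc n))    ≈⟨ ⁻¹-∙-comm _ _ ⟨
    - ι (suc m) + - ι (suc n)    ∎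

  fromℤ-+* : ∀ m j → fromℤ (+ m ⊛ j) ≈ ι m * fromℤ j
  fromℤ-+* m (+ n)    = trans (reflexive (cong fromℤ (≡.sym (ℤP.pos-* m n)))) (ι-* m n)
  fromℤ-+* m -[1+ n ] = begin
    fromℤ (+ m ⊛ -[1+ n ])         ≡⟨ cong fromℤ (≡.sym (ℤP.neg-distribʳ-* (+ m) (+ suc n))) ⟩
    fromℤ (Int.- (+ m ⊛ + suc n))  ≈⟨ fromℤ-neg (+ m ⊛ + suc n) ⟩
    - fromℤ (+ m ⊛ + suc n)        ≈⟨ -‿cong (fromℤ-+* m (+ suc n)) ⟩
    - (ι m * ι (suc n))            ≈⟨ -‿distribʳ-* _ _ ⟩
    ι m * - ι (suc n)              ∎

  fromℤ-* : ∀ i j → fromℤ (i ⊛ j) ≈ fromℤ i * fromℤ j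
  fromℤ-* (+ m)    j = fromℤ-+* m j
  fromℤ-* -[1+ m ] j = begin
    fromℤ (-[1+ m ] ⊛ j)         ≡⟨ cong fromℤ (≡.sym (ℤP.neg-distribˡ-* (+ suc m) j)) ⟩
    fromℤ (Int.- (+ suc m ⊛ j))  ≈⟨ fromℤ-neg (+ suc m ⊛ j) ⟩
    - fromℤ (+ suc m ⊛ j)        ≈⟨ -‿cong (fromℤ-+* (suc m) j) ⟩
    - (ι (suc m) * fromℤ j)      ≈⟨ -‿distribˡ-* _ _ ⟩
    - ι (suc m) * fromℤ j        ∎

  fromℤ-homomorphism : Int.+-*-rawRing -Raw-AlmostCommutative⟶ fromCommutativeRing K
  fromℤ-homomorphism = record
    { ⟦_⟧ = fromℤ ; +-homo = fromℤ-+ ; *-homo = fromℤ-* ; -‿homo = fromℤ-neg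
    ; 0-homo = refl ; 1-homo = refl }

  fromℤ-≟ : ∀ i j → Maybe (fromℤ i ≈ fromℤ j)
  fromℤ-≟ i j with i Int.≟ j
  ... | yes ≡.refl = just refl
  ... | no _     = nothing

  open Algebra.Solver.Ring Int.+-*-rawRing (fromCommutativeRing K) fromℤ-homomorphism fromℤ-≟
    using (solve; _:+_; _:*_; _:-_; :-_; _:=_; con)

  infixr 8 _^_
  _^_ : Carrier → ℕ → Carrier
  _^_ = pow K

  ascP : ℕ → Carrier → ℕ → Carrier
  ascP n z zero    = 0#
  ascP n z (suc i) = ascP n z i + ι (n C ⌊ i /2⌋) * z ^ i

  fromℕ-𝓑≈ι : ∀ n k → fromℕ K (𝓑 K n k) ≈ ι (n C ⌊ n ∸ k /2⌋)
  fromℕ-𝓑≈ι n k = trans (fromℕ≈ι (𝓑 K n k)) (reflexive (cong (λ h → ι (n C h)) (n/2≡⌊n/2⌋ (n ∸ k))))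

  partialP+ascP≈ascP : ∀ n z m → m ≤ n → partialP K n z m + ascP n z (n ∸ m) ≈ ascP n z (suc n)
  partialP+ascP≈ascP n z zero _ = trans (+-comm _ _) (+-congˡ (*-congʳ (fromℕ-𝓑≈ι n 0)))
  partialP+ascP≈ascP n z (suc m) m<n = begin
    partialP K n z m + fromℕ K (𝓑 K n (suc m)) * z ^ j + ascP n z j
      ≈⟨ +-assoc _ _ _ ⟩
    partialP K n z m + (fromℕ K (𝓑 K n (suc m)) * z ^ j + ascP n z j)
      ≈⟨ +-congˡ (trans (+-comm _ _) (+-congˡ (*-congʳ (fromℕ-𝓑≈ι n (suc m))))) ⟩
    partialP K n z m + ascP n z (suc j)
      ≡⟨ cong (λ i → partialP K n z m + ascP n z i) (≡.sym (ℕP.+-∸-assoc 1 m<n)) ⟩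
    partialP K n z m + ascP n z (n ∸ m)
      ≈⟨ partialP+ascP≈ascP n z m (ℕP.<⇒≤ m<n) ⟩
    ascP n z (suc n) ∎
    where j = n ∸ suc m

  P≈ascP : ∀ n z → P K n z ≈ ascP n z (suc n)
  P≈ascP n z = begin
    P K n z                     ≈⟨ +-identityʳ _ ⟨
    P K n z + ascP n z 0        ≡⟨ cong (λ i → P K n z + ascP n z i) (≡.sym (ℕP.n∸n≡0 n)) ⟩
    P K n z + ascP n z (n ∸ n)  ≈⟨ partialP+ascP≈ascP n z n ℕP.≤-refl ⟩
    ascP n z (suc n)            ∎

  ascP-pascal : ∀ n z i → ascP (suc n) z (suc (suc i)) ≈ ascP n z (suc (suc i)) + z * z * ascP n z i
  ascP-pascal n z zero    = sym (trans (+-congˡ (zeroʳ _)) (+-identityʳ _))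
  ascP-pascal n z (suc i) = begin
    ascP (suc n) z (suc (suc i)) + ι (suc n C suc h) * z ^ suc (suc i)
      ≈⟨ +-cong (ascP-pascal n z i) (*-congʳ (reflexive (cong ι (≡.sym (nCk+nC[k+1]≡[n+1]C[k+1] n h))))) ⟩
    ascP n z (suc (suc i)) + z * z * ascP n z i + ι (n C h Nat.+ n C suc h) * (z * (z * z ^ i))
      ≈⟨ +-congˡ (*-congʳ (ι-+ (n C h) (n C suc h))) ⟩
    ascP n z (suc (suc i)) + z * z * ascP n z i + (ι (n C h) + ι (n C suc h)) * (z * (z * z ^ i))
      ≈⟨ solve 6 (λ X Y A B z w → X :+ z :* z :* Y :+ (A :+ B) :* (z :* (z :* w))
                                  := X :+ B :* (z :* (z :* w)) :+ z :* z :* (Y :+ A :* w))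
               refl (ascP n z (suc (suc i))) (ascP n z i) (ι (n C h)) (ι (n C suc h)) z (z ^ i) ⟩
    ascP n z (suc (suc (suc i))) + z * z * ascP n z (suc i) ∎
    where h = ⌊ i /2⌋

  P-suc : ∀ n z → P K (suc n) z ≈ (1# + z * z) * P K n z + ι (central n) * (z * z ^ n) * (1# - z)
  P-suc n z = begin
    P K (suc n) z
      ≈⟨ P≈ascP (suc n) z ⟩
    ascP (suc n) z (suc (suc n))
      ≈⟨ ascP-pascal n z n ⟩
    ascP n z n + ι (central n) * z ^ n + ι (n C ⌈ n /2⌉) * (z * z ^ n) + z * z * ascP n z n
      ≡⟨ cong (λ b → ascP n z n + ι (central n) * z ^ n + ι b * (z * z ^ n) + z * z * ascP n z n)
              (≡.sym (central≡nC⌈n/2⌉ n)) ⟩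
    ascP n z n + ι (central n) * z ^ n + ι (central n) * (z * z ^ n) + z * z * ascP n z n
      ≈⟨ solve 4 (λ Y B z w → Y :+ B :* w :+ B :* (z :* w) :+ z :* z :* Y
                             := (con (+ 1) :+ z :* z) :* (Y :+ B :* w) :+ B :* (z :* w) :* (con (+ 1) :- z))
               refl (ascP n z n) (ι (central n)) z (z ^ n) ⟩
    (1# + z * z) * ascP n z (suc n) + ι (central n) * (z * z ^ n) * (1# - z)
      ≈⟨ +-congʳ (*-congˡ (P≈ascP n z)) ⟨
    (1# + z * z) * P K n z + ι (central n) * (z * z ^ n) * (1# - z) ∎

  ^-congˡ : ∀ {x y} n → x ≈ y → x ^ n ≈ y ^ n
  ^-congˡ zero    x≈y = refl
  ^-congˡ (suc n) x≈y = *-cong x≈y (^-congˡ n x≈y)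

  partialP-congʳ : ∀ n m {z z′} → z ≈ z′ → partialP K n z m ≈ partialP K n z′ m
  partialP-congʳ n zero    z≈z′ = *-congˡ (^-congˡ n z≈z′)
  partialP-congʳ n (suc m) z≈z′ = +-cong (partialP-congʳ n m z≈z′) (*-congˡ (^-congˡ (n ∸ suc m) z≈z′))

  P-congʳ : ∀ n {z z′} → z ≈ z′ → P K n z ≈ P K n z′
  P-congʳ n = partialP-congʳ n n

  P[0]≈1 : ∀ n → P K n 0# ≈ 1#
  P[0]≈1 zero    = trans (*-identityʳ _) (+-identityʳ 1#)
  P[0]≈1 (suc n) = begin
    P K (suc n) 0#
      ≈⟨ P-suc n 0# ⟩
    (1# + 0# * 0#) * P K n 0# + ι (central n) * (0# * 0# ^ n) * (1# - 0#)
      ≈⟨ solve 3 (λ Y B w → (con (+ 1) :+ con (+ 0) :* con (+ 0)) :* Y :+ B :* (con (+ 0) :* w) :* (con (+ 1) :- con (+ 0)) := Y)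
               refl (P K n 0#) (ι (central n)) (0# ^ n) ⟩
    P K n 0#
      ≈⟨ P[0]≈1 n ⟩
    1# ∎

  P[1]≈2^n : ∀ n → P K n 1# ≈ ι (2 Nat.^ n)
  P[1]≈2^n zero    = trans (*-identityʳ _) (+-identityʳ 1#)
  P[1]≈2^n (suc n) = begin
    P K (suc n) 1#
      ≈⟨ P-suc n 1# ⟩
    (1# + 1# * 1#) * P K n 1# + ι (central n) * (1# * 1# ^ n) * (1# - 1#)
      ≈⟨ solve 3 (λ Y B w → (con (+ 1) :+ con (+ 1) :* con (+ 1)) :* Y :+ B :* (con (+ 1) :* w) :* (con (+ 1) :- con (+ 1))
                           := con (+ 2) :* Y)
               refl (P K n 1#) (ι (central n)) (1# ^ n) ⟩
    ι 2 * P K n 1#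
      ≈⟨ *-congˡ (P[1]≈2^n n) ⟩
    ι 2 * ι (2 Nat.^ n)
      ≈⟨ ι-* 2 (2 Nat.^ n) ⟨
    ι (2 Nat.^ suc n) ∎

  module _ (m c : ℕ) {z : Carrier} (q≈0 : ι m * (1# + z * z) + ι c * z ≈ 0#) where

    m^j*P≈z^j*remainder : ∀ j →
      ι (m Nat.^ j) * P K j z ≈ z ^ j * (fromℤ ((Int.- (+ c)) Int.^ j) + fromℤ (rem m c j) * (1# - z))
    m^j*P≈z^j*remainder zero = solve 1 (λ z → con (+ 1) :* ((con (+ 1) :+ con (+ 0)) :* con (+ 1))
                                           := con (+ 1) :* (con (+ 1) :+ con (+ 0) :* (con (+ 1) :- z))) refl z
    m^j*P≈z^j*remainder (suc j) = begin
      ι (m Nat.^ suc j) * P K (suc j) z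
        ≈⟨ *-cong (ι-* m (m Nat.^ j)) (P-suc j z) ⟩
      m̂ * A * ((1# + z * z) * P K j z + B * (z * w) * (1# - z))
        ≈⟨ solve 7 (λ m̂ ĉ A B Y z w → m̂ :* A :* ((con (+ 1) :+ z :* z) :* Y :+ B :* (z :* w) :* (con (+ 1) :- z))
                     := (m̂ :* (con (+ 1) :+ z :* z) :+ ĉ :* z) :* (A :* Y) :+ z :* (:- ĉ :* (A :* Y) :+ m̂ :* A :* B :* w :* (con (+ 1) :- z)))
                 refl m̂ ĉ A B (P K j z) z w ⟩
      (m̂ * (1# + z * z) + ĉ * z) * (A * P K j z) + z * (- ĉ * (A * P K j z) + m̂ * A * B * w * (1# - z))
        ≈⟨ +-cong (*-congʳ q≈0) (*-congˡ (+-congʳ (*-congˡ (m^j*P≈z^j*remainder j)))) ⟩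
      0# * (A * P K j z) + z * (- ĉ * (w * (E + S * (1# - z))) + m̂ * A * B * w * (1# - z))
        ≈⟨ solve 9 (λ m̂ ĉ A B Y z w E S →
                     con (+ 0) :* (A :* Y) :+ z :* (:- ĉ :* (w :* (E :+ S :* (con (+ 1) :- z))) :+ m̂ :* A :* B :* w :* (con (+ 1) :- z))
                     := z :* w :* (:- ĉ :* E :+ (:- ĉ :* S :+ m̂ :* A :* B) :* (con (+ 1) :- z)))
                 refl m̂ ĉ A B (P K j z) z w E S ⟩
      z * w * (- ĉ * E + (- ĉ * S + m̂ * A * B) * (1# - z))
        ≈⟨ *-congˡ (+-cong e-step (*-congʳ rem-step)) ⟨
      z ^ suc j * (fromℤ ((Int.- (+ c)) Int.^ suc j) + fromℤ (rem m c (suc j)) * (1# - z)) ∎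
      where
      m̂ = ι m
      ĉ = ι c
      A = ι (m Nat.^ j)
      B = ι (central j)
      w = z ^ j
      E = fromℤ ((Int.- (+ c)) Int.^ j)
      S = fromℤ (rem m c j)
      e-step : fromℤ ((Int.- (+ c)) Int.^ suc j) ≈ - ĉ * E
      e-step = trans (fromℤ-* (Int.- (+ c)) _) (*-congʳ (fromℤ-neg (+ c)))
      rem-step : fromℤ (rem m c (suc j)) ≈ - ĉ * S + m̂ * A * B
      rem-step = trans (fromℤ-+ (Int.- (+ c) ⊛ rem m c j) _)
        (+-cong (trans (fromℤ-* (Int.- (+ c)) _) (*-congʳ (fromℤ-neg (+ c))))
                (trans (ι-* (m Nat.^ suc j) (central j)) (*-congʳ (ι-* m (m Nat.^ j)))))

  ι[m+m+c] : ∀ m c → ι (m Nat.+ m Nat.+ c) ≈ ι m + ι m + ι c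
  ι[m+m+c] m c = trans (ι-+ (m Nat.+ m) c) (+-congʳ (ι-+ m m))

  fromℤ-form : ∀ m c e s →
    fromℤ (+ m ⊛ (e ⊛ e) ⊕ + (m Nat.+ m Nat.+ c) ⊛ (e ⊛ s) ⊕ + (m Nat.+ m Nat.+ c) ⊛ (s ⊛ s))
      ≈ ι m * (fromℤ e * fromℤ e) + (ι m + ι m + ι c) * (fromℤ e * fromℤ s) + (ι m + ι m + ι c) * (fromℤ s * fromℤ s)
  fromℤ-form m c e s = begin
    fromℤ (+ m ⊛ (e ⊛ e) ⊕ + d ⊛ (e ⊛ s) ⊕ + d ⊛ (s ⊛ s))
      ≈⟨ fromℤ-+ (+ m ⊛ (e ⊛ e) ⊕ + d ⊛ (e ⊛ s)) (+ d ⊛ (s ⊛ s)) ⟩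
    fromℤ (+ m ⊛ (e ⊛ e) ⊕ + d ⊛ (e ⊛ s)) + fromℤ (+ d ⊛ (s ⊛ s))
      ≈⟨ +-congʳ (fromℤ-+ (+ m ⊛ (e ⊛ e)) (+ d ⊛ (e ⊛ s))) ⟩
    fromℤ (+ m ⊛ (e ⊛ e)) + fromℤ (+ d ⊛ (e ⊛ s)) + fromℤ (+ d ⊛ (s ⊛ s))
      ≈⟨ +-cong (+-cong (fromℤ-+* m (e ⊛ e)) (fromℤ-+* d (e ⊛ s))) (fromℤ-+* d (s ⊛ s)) ⟩
    ι m * fromℤ (e ⊛ e) + ι d * fromℤ (e ⊛ s) + ι d * fromℤ (s ⊛ s)
      ≈⟨ +-cong (+-cong (*-congˡ (fromℤ-* e e)) (*-cong (ι[m+m+c] m c) (fromℤ-* e s)))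
                (*-cong (ι[m+m+c] m c) (fromℤ-* s s)) ⟩
    ι m * (fromℤ e * fromℤ e) + (ι m + ι m + ι c) * (fromℤ e * fromℤ s) + (ι m + ι m + ι c) * (fromℤ s * fromℤ s) ∎
    where d = m Nat.+ m Nat.+ c

  fromℤ-linear : ∀ m c e s →
    fromℤ (+ (m Nat.+ m) ⊛ e ⊕ + (m Nat.+ m Nat.+ c) ⊛ s) ≈ (ι m + ι m) * fromℤ e + (ι m + ι m + ι c) * fromℤ s
  fromℤ-linear m c e s = begin
    fromℤ (+ (m Nat.+ m) ⊛ e ⊕ + (m Nat.+ m Nat.+ c) ⊛ s)
      ≈⟨ fromℤ-+ (+ (m Nat.+ m) ⊛ e) (+ (m Nat.+ m Nat.+ c) ⊛ s) ⟩
    fromℤ (+ (m Nat.+ m) ⊛ e) + fromℤ (+ (m Nat.+ m Nat.+ c) ⊛ s)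
      ≈⟨ +-cong (fromℤ-+* (m Nat.+ m) e) (fromℤ-+* (m Nat.+ m Nat.+ c) s) ⟩
    ι (m Nat.+ m) * fromℤ e + ι (m Nat.+ m Nat.+ c) * fromℤ s
      ≈⟨ +-cong (*-congʳ (ι-+ m m)) (*-congʳ (ι[m+m+c] m c)) ⟩
    (ι m + ι m) * fromℤ e + (ι m + ι m + ι c) * fromℤ s ∎

  module _ (isField : IsCharZeroField K) where

    open IsCharZeroField isField

    ι≉0 : ∀ {n} → 0 Nat.< n → ¬ ι n ≈ 0#
    ι≉0 {suc n} _ ι≈0 = charZero n (trans (fromℕ≈ι (suc n)) ι≈0)

    fromℤ≈0⇒≡0 : ∀ i → fromℤ i ≈ 0# → i ≡ 0ℤ
    fromℤ≈0⇒≡0 (+ zero)     _   = ≡.refl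
    fromℤ≈0⇒≡0 Int.+[1+ n ] i≈0 = ⊥-elim (ι≉0 {suc n} (Nat.s≤s Nat.z≤n) i≈0)
    fromℤ≈0⇒≡0 -[1+ n ]     i≈0 =
      ⊥-elim (ι≉0 {suc n} (Nat.s≤s Nat.z≤n) (trans (sym (⁻¹-involutive _)) (trans (-‿cong i≈0) ε⁻¹≈ε)))

    x*y≈0⇒y≈0 : ∀ {x y} → ¬ x ≈ 0# → x * y ≈ 0# → y ≈ 0#
    x*y≈0⇒y≈0 {x} {y} x≉0 xy≈0 with inverse x x≉0
    ... | x⁻¹ , xx⁻¹≈1 = begin
      y              ≈⟨ *-identityˡ y ⟨
      1# * y         ≈⟨ *-congʳ xx⁻¹≈1 ⟨
      x * x⁻¹ * y    ≈⟨ *-congʳ (*-comm x x⁻¹) ⟩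
      x⁻¹ * x * y    ≈⟨ *-assoc x⁻¹ x y ⟩
      x⁻¹ * (x * y)  ≈⟨ *-congˡ xy≈0 ⟩
      x⁻¹ * 0#       ≈⟨ zeroʳ x⁻¹ ⟩
      0#             ∎

    ^≉0 : ∀ {z} → ¬ z ≈ 0# → ∀ n → ¬ z ^ n ≈ 0#
    ^≉0 z≉0 zero          = nontrivial
    ^≉0 z≉0 (suc n) zzⁿ≈0 = ^≉0 z≉0 n (x*y≈0⇒y≈0 z≉0 zzⁿ≈0)

    P≈0⇒z≉0 : ∀ n {z} → P K n z ≈ 0# → ¬ z ≈ 0#
    P≈0⇒z≉0 n P≈0 z≈0 = nontrivial (trans (sym (P[0]≈1 n)) (trans (P-congʳ n (sym z≈0)) P≈0))

    P≈0⇒1-z≉0 : ∀ n {z} → P K n z ≈ 0# → ¬ 1# - z ≈ 0#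
    P≈0⇒1-z≉0 n P≈0 1-z≈0 = ι≉0 (ℕP.m^n>0 2 n)
      (trans (sym (P[1]≈2^n n)) (trans (P-congʳ n (x∙y⁻¹≈ε⇒x≈y _ _ 1-z≈0)) P≈0))

    common-root⇒central-relation : ∀ N {z} → P K (suc (suc N)) z ≈ 0# → P K N z ≈ 0# →
      ι (central N) * (1# + z * z) + ι (central (suc N)) * z ≈ 0#
    common-root⇒central-relation N {z} P[2+N]≈0 P[N]≈0 =
      x*y≈0⇒y≈0 (P≈0⇒1-z≉0 N P[N]≈0) (x*y≈0⇒y≈0 (^≉0 (P≈0⇒z≉0 N P[N]≈0) (suc N)) (begin
        z * w * ((1# - z) * (b₀ * u + b₁ * z))
          ≈⟨ solve 5 (λ b₀ b₁ Y z w →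
               z :* w :* ((con (+ 1) :- z) :* (b₀ :* (con (+ 1) :+ z :* z) :+ b₁ :* z))
               := (con (+ 1) :+ z :* z) :* ((con (+ 1) :+ z :* z) :* Y :+ b₀ :* (z :* w) :* (con (+ 1) :- z))
                  :+ b₁ :* (z :* (z :* w)) :* (con (+ 1) :- z) :- (con (+ 1) :+ z :* z) :* (con (+ 1) :+ z :* z) :* Y)
               refl b₀ b₁ (P K N z) z w ⟩
        u * (u * P K N z + b₀ * (z * w) * (1# - z)) + b₁ * (z * (z * w)) * (1# - z) - u * u * P K N z
          ≈⟨ +-cong (trans (P-suc (suc N) z) (+-congʳ (*-congˡ (P-suc N z)))) (-‿cong (*-congˡ (sym P[N]≈0))) ⟨
        P K (suc (suc N)) z - u * u * 0#
          ≈⟨ +-congʳ P[2+N]≈0 ⟩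
        0# - u * u * 0#
          ≈⟨ solve 1 (λ u → con (+ 0) :- u :* u :* con (+ 0) := con (+ 0)) refl u ⟩
        0# ∎))
      where
      u  = 1# + z * z
      w  = z ^ N
      b₀ = ι (central N)
      b₁ = ι (central (suc N))

    common-root⇒quadratic : ∀ N {z} → P K (suc (suc N)) z ≈ 0# → P K N z ≈ 0# →
      ι (suc ⌊ N /2⌋) * (1# + z * z) + ι (suc N) * z ≈ 0#
    common-root⇒quadratic N {z} P[2+N]≈0 P[N]≈0 = x*y≈0⇒y≈0 (ι≉0 (central>0 N)) (begin
      b₀ * (m̂ * (1# + z * z) + ĉ * z)
        ≈⟨ solve 5 (λ b₀ b₁ m̂ ĉ z → b₀ :* (m̂ :* (con (+ 1) :+ z :* z) :+ ĉ :* z)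
                     := m̂ :* (b₀ :* (con (+ 1) :+ z :* z) :+ b₁ :* z) :+ (ĉ :* b₀ :- m̂ :* b₁) :* z)
             refl b₀ b₁ m̂ ĉ z ⟩
      m̂ * (b₀ * (1# + z * z) + b₁ * z) + (ĉ * b₀ - m̂ * b₁) * z
        ≈⟨ +-cong (*-congˡ (common-root⇒central-relation N P[2+N]≈0 P[N]≈0)) (*-congʳ (x≈y⇒x∙y⁻¹≈ε ĉb₀≈m̂b₁)) ⟩
      m̂ * 0# + 0# * z
        ≈⟨ solve 2 (λ m̂ z → m̂ :* con (+ 0) :+ con (+ 0) :* z := con (+ 0)) refl m̂ z ⟩
      0# ∎)
      where
      m̂  = ι (suc ⌊ N /2⌋)
      ĉ  = ι (suc N)
      b₀ = ι (central N)
      b₁ = ι (central (suc N))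
      ĉb₀≈m̂b₁ : ĉ * b₀ ≈ m̂ * b₁
      ĉb₀≈m̂b₁ = begin
        ĉ * b₀                                 ≈⟨ ι-* (suc N) (central N) ⟨
        ι (suc N Nat.* central N)              ≡⟨ cong ι ([1+⌊n/2⌋]*central[1+n]≡[1+n]*central[n] N) ⟨
        ι (suc ⌊ N /2⌋ Nat.* central (suc N))  ≈⟨ ι-* (suc ⌊ N /2⌋) (central (suc N)) ⟩
        m̂ * b₁                                ∎

    linear∧quadratic-root⇒≈-1 : ∀ m c {z} → 0 Nat.< c →
      ι c + (ι m + ι m) * z ≈ 0# → ι m * (1# + z * z) + ι c * z ≈ 0# → z ≈ - 1#
    linear∧quadratic-root⇒≈-1 m c {z} c>0 lin≈0 q≈0 =
      inverseʳ-unique 1# z (x*y≈0⇒y≈0 (ι≉0 c>0) (begin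
        ĉ * (1# + z)
          ≈⟨ solve 3 (λ m̂ ĉ z → ĉ :* (con (+ 1) :+ z) := ĉ :+ (m̂ :+ m̂) :* z :- ((m̂ :+ m̂) :- ĉ) :* z) refl m̂ ĉ z ⟩
        ĉ + (m̂ + m̂) * z - ((m̂ + m̂) - ĉ) * z
          ≈⟨ +-cong lin≈0 (-‿cong (*-congʳ T≈0)) ⟩
        0# - 0# * z
          ≈⟨ solve 1 (λ z → con (+ 0) :- con (+ 0) :* z := con (+ 0)) refl z ⟩
        0# ∎))
      where
      m̂ = ι m
      ĉ = ι c
      T≈0 : (m̂ + m̂) - ĉ ≈ 0#
      T≈0 = x*y≈0⇒y≈0 (λ D≈0 → ι≉0 (ℕP.<-≤-trans c>0 (ℕP.m≤n+m c (m Nat.+ m))) (trans (ι[m+m+c] m c) D≈0)) (begin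
        (m̂ + m̂ + ĉ) * ((m̂ + m̂) - ĉ)
          ≈⟨ solve 3 (λ m̂ ĉ z → (m̂ :+ m̂ :+ ĉ) :* ((m̂ :+ m̂) :- ĉ)
                       := (m̂ :+ m̂ :+ m̂ :+ m̂) :* (m̂ :* (con (+ 1) :+ z :* z) :+ ĉ :* z)
                          :- (ĉ :+ (m̂ :+ m̂) :* z) :* (ĉ :+ (m̂ :+ m̂) :* z)) refl m̂ ĉ z ⟩
        (m̂ + m̂ + m̂ + m̂) * (m̂ * (1# + z * z) + ĉ * z) - (ĉ + (m̂ + m̂) * z) * (ĉ + (m̂ + m̂) * z)
          ≈⟨ +-cong (*-congˡ q≈0) (-‿cong (*-cong lin≈0 lin≈0)) ⟩
        (m̂ + m̂ + m̂ + m̂) * 0# - 0# * 0#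
          ≈⟨ solve 1 (λ x → x :* con (+ 0) :- con (+ 0) :* con (+ 0) := con (+ 0)) refl (m̂ + m̂ + m̂ + m̂) ⟩
        0# ∎)

    e+s[1-z]≈0⇒2me+[2m+c]s≡0 : ∀ m c e s {z} → c ≤ m Nat.+ m →
      ι m * (1# + z * z) + ι c * z ≈ 0# → fromℤ e + fromℤ s * (1# - z) ≈ 0# →
      + (m Nat.+ m) ⊛ e ⊕ + (m Nat.+ m Nat.+ c) ⊛ s ≡ 0ℤ
    e+s[1-z]≈0⇒2me+[2m+c]s≡0 m c e s {z} c≤2m q≈0 e+s[1-z]≈0 =
      form≡0⇒linear≡0 m c e s c≤2m (fromℤ≈0⇒≡0 _ (begin
        fromℤ (+ m ⊛ (e ⊛ e) ⊕ d ⊛ (e ⊛ s) ⊕ d ⊛ (s ⊛ s))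
          ≈⟨ fromℤ-form m c e s ⟩
        m̂ * (E * E) + D * (E * S) + D * (S * S)
          ≈⟨ solve 5 (λ m̂ ĉ E S z → m̂ :* (E :* E) :+ (m̂ :+ m̂ :+ ĉ) :* (E :* S) :+ (m̂ :+ m̂ :+ ĉ) :* (S :* S)
                       := (E :+ S :* (con (+ 1) :- z)) :* (m̂ :* E :- m̂ :* S :* (con (+ 1) :- z) :+ (m̂ :+ m̂ :+ ĉ) :* S)
                          :+ S :* S :* (m̂ :* (con (+ 1) :+ z :* z) :+ ĉ :* z))
               refl m̂ ĉ E S z ⟩
        (E + S * (1# - z)) * (m̂ * E - m̂ * S * (1# - z) + D * S) + S * S * (m̂ * (1# + z * z) + ĉ * z)
          ≈⟨ +-cong (*-congʳ e+s[1-z]≈0) (*-congˡ q≈0) ⟩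
        0# * (m̂ * E - m̂ * S * (1# - z) + D * S) + S * S * 0#
          ≈⟨ solve 2 (λ x y → con (+ 0) :* x :+ y :* con (+ 0) := con (+ 0)) refl (m̂ * E - m̂ * S * (1# - z) + D * S) (S * S) ⟩
        0# ∎))
      where
      m̂ = ι m
      ĉ = ι c
      D = m̂ + m̂ + ĉ
      d = + (m Nat.+ m Nat.+ c)
      E = fromℤ e
      S = fromℤ s

    quadratic-root∧P-root⇒≈-1 : ∀ m c N {z} → 0 Nat.< c → c ≤ m Nat.+ m →
      ι m * (1# + z * z) + ι c * z ≈ 0# → P K N z ≈ 0# → z ≈ - 1#
    quadratic-root∧P-root⇒≈-1 m c N {z} c>0 c≤2m q≈0 P≈0 = linear∧quadratic-root⇒≈-1 m c c>0 lin≈0 q≈0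
      where
      m̂ = ι m
      ĉ = ι c
      e = (Int.- (+ c)) Int.^ N
      E = fromℤ e
      S = fromℤ (rem m c N)

      E+S[1-z]≈0 : E + S * (1# - z) ≈ 0#
      E+S[1-z]≈0 = x*y≈0⇒y≈0 (^≉0 (P≈0⇒z≉0 N P≈0) N)
        (trans (sym (m^j*P≈z^j*remainder m c q≈0 N)) (trans (*-congˡ P≈0) (zeroʳ _)))

      S≉0 : ¬ S ≈ 0#
      S≉0 S≈0 = e≢0 (fromℤ≈0⇒≡0 e (begin
        E                 ≈⟨ +-identityʳ E ⟨
        E + 0#            ≈⟨ +-congˡ (trans (*-congʳ S≈0) (zeroˡ _)) ⟨
        E + S * (1# - z)  ≈⟨ E+S[1-z]≈0 ⟩
        0#                ∎))
        where
        e≢0 : ¬ e ≡ 0ℤ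
        e≢0 e≡0 = ℕP.<⇒≢ c>0 (≡.sym (ℤP.+-injective (ℤP.neg-injective (ℤP.i^n≡0⇒i≡0 _ N e≡0))))

      lin≈0 : ĉ + (m̂ + m̂) * z ≈ 0#
      lin≈0 = x*y≈0⇒y≈0 S≉0 (begin
        S * (ĉ + (m̂ + m̂) * z)
          ≈⟨ solve 5 (λ m̂ ĉ E S z → S :* (ĉ :+ (m̂ :+ m̂) :* z)
                       := (m̂ :+ m̂) :* E :+ (m̂ :+ m̂ :+ ĉ) :* S :- (m̂ :+ m̂) :* (E :+ S :* (con (+ 1) :- z)))
               refl m̂ ĉ E S z ⟩
        (m̂ + m̂) * E + (m̂ + m̂ + ĉ) * S - (m̂ + m̂) * (E + S * (1# - z))
          ≈⟨ +-cong (trans (sym (fromℤ-linear m c e (rem m c N)))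
                           (reflexive (cong fromℤ (e+s[1-z]≈0⇒2me+[2m+c]s≡0 m c e _ c≤2m q≈0 E+S[1-z]≈0))))
                    (-‿cong (*-congˡ E+S[1-z]≈0)) ⟩
        0# - (m̂ + m̂) * 0#
          ≈⟨ solve 1 (λ x → con (+ 0) :- x :* con (+ 0) := con (+ 0)) refl (m̂ + m̂) ⟩
        0# ∎)

corollary4p3 : ∀ {c ℓ : Level} (K : CommutativeRing c ℓ) → IsCharZeroField K →
    ∀ (n : ℕ) → 2 ≤ n → ∀ (z : CommutativeRing.Carrier K) →
    CommutativeRing._≈_ K (P K n z) (CommutativeRing.0# K) →
    CommutativeRing._≈_ K (P K (n ∸ 2) z) (CommutativeRing.0# K) →
    CommutativeRing._≈_ K z (CommutativeRing.-_ K (CommutativeRing.1# K))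
corollary4p3 K isField (suc (suc N)) (Nat.s≤s (Nat.s≤s _)) z P[2+N]≈0 P[N]≈0 =
  quadratic-root∧P-root⇒≈-1 K isField (suc ⌊ N /2⌋) (suc N) N (Nat.s≤s Nat.z≤n) (1+n≤2[1+⌊n/2⌋] N)
    (common-root⇒quadratic K isField N P[2+N]≈0 P[N]≈0) P[N]≈0
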